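{- Fix integers $1\leq k\leq n$ and write $n=ka+b$ with integers $a\geq 0$ and $0\leq b\leq k-1$. Then \[|\mathrm{VPF}_n(k)| \;=\; \left(\frac{n!}{\prod_{t=0}^{k-1}\left\lfloor\frac{n+t}{k}\right\rfloor!}\right)\cdot|\mathrm{VPF}_{a+1}|^b\cdot|\mathrm{VPF}_{a}|^{k-b},\] where $|\mathrm{VPF}_{0}|\coloneqq 1$.
   Context: For $n\in\mathbb{N}$ let $[n]=\{1,\dots,n\}$. Fix $k\in[n]$. A preference list $\alpha=(a_1,\dots,a_n)\in[n]^n$ describes $n$ cars entering, in order $i=1,2,\dots,n$, a one-way street with parking spots numbered $1,\dots,n$; car $i$ prefers spot $a_i$. Under the $k$-vacillating parking rule, car $i$ parks in spot $a_i$ if it is unoccupied; otherwise it checks spot $a_i-k$ and parks there if that spot exists and is unoccupied; otherwise it checks spot $a_i+k$ and parks there if that spot exists and is unoccupied; otherwise car $i$ fails to park. If all $n$ cars park, $\alpha$ is a $k$-vacillating parking function of length $n$. $\mathrm{VPF}_n(k)$ denotes the set of these, and $\mathrm{VPF}_n\coloneqq\mathrm{VPF}_n(1)$ (the vacillating parking functions of length $n$). -}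

module Defs where

open import Data.Nat using (ℕ; zero; suc; _+_; _*_; _∸_; _<ᵇ_; _≤ᵇ_; _≡ᵇ_; NonZero; _/_)
open import Data.Nat using (_!)
open import Data.Bool.ListAction using (any)
open import Data.Nat.ListAction using (product)
open import Data.Nat.Properties using (m*n≢0; _!≢0)
open import Data.Bool using (Bool; true; false; if_then_else_; not; _∧_)
open import Data.List using (List; []; _∷_; upTo; map; concatMap; filterᵇ; length)
open import Data.Vec using (Vec; []; _∷_)
open import Data.Maybe using (Maybe; just; nothing)

-- Spots and preferences are natural numbers in [n] = {1,…,n}.

occupied : List ℕ → ℕ → Bool
occupied occ s = any (λ t → t ≡ᵇ s) occ

parkCar : (n k : ℕ) → List ℕ → ℕ → Maybe (List ℕ)
parkCar n k occ a =
  if not (occupied occ a) then just (a ∷ occ)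
  else if (k <ᵇ a) ∧ not (occupied occ (a ∸ k))          -- spot a-k exists (a-k ≥ 1)
       then just ((a ∸ k) ∷ occ)
  else if ((a + k) ≤ᵇ n) ∧ not (occupied occ (a + k))
       then just ((a + k) ∷ occ)
  else nothing

parkAll : (n k : ℕ) → List ℕ → {m : ℕ} → Vec ℕ m → Maybe (List ℕ)
parkAll n k occ [] = just occ
parkAll n k occ (a ∷ as) with parkCar n k occ a
... | nothing   = nothing
... | just occ' = parkAll n k occ' as

isVPF : (n k : ℕ) → Vec ℕ n → Bool
isVPF n k α with parkAll n k [] α
... | just _  = true
... | nothing = false

prefLists : (n m : ℕ) → List (Vec ℕ m)
prefLists n zero    = [] ∷ []
prefLists n (suc m) = concatMap (λ i → map (suc i ∷_) (prefLists n m)) (upTo n)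

vpfCount : (n k : ℕ) → ℕ
vpfCount n k = length (filterᵇ (isVPF n k) (prefLists n n))

vpfCount1 : ℕ → ℕ
vpfCount1 zero    = 1
vpfCount1 (suc m) = vpfCount (suc m) 1

-- ∏_{t=0}^{k-1} ⌊(n+t)/k⌋!   (k = 0 gives the empty product; irrelevant since k ≥ 1)
floorFactProd : (n k : ℕ) → ℕ
floorFactProd n zero    = 1
floorFactProd n (suc j) = product (map (λ t → ((n + t) / suc j) !) (upTo (suc j)))

prodFactNZ : (f : ℕ → ℕ) (xs : List ℕ) → NonZero (product (map (λ t → f t !) xs))
prodFactNZ f []       = _
prodFactNZ f (x ∷ xs) = m*n≢0 (f x !) _ {{f x !≢0}} {{prodFactNZ f xs}}

floorFactProdNZ : (n k : ℕ) → NonZero (floorFactProd n k)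
floorFactProdNZ n zero    = _
floorFactProdNZ n (suc j) = prodFactNZ (λ t → (n + t) / suc j) (upTo (suc j))

-- multinomial coefficient n! / ∏_{t=0}^{k-1} ⌊(n+t)/k⌋!  (exact division in ℕ)
multinom : (n k : ℕ) → ℕ
multinom n k = (n ! / floorFactProd n k) {{floorFactProdNZ n k}}

-- Under the k-vacillating rule a car preferring spot s inspects only s and s ∓ k, so every residue
-- class of spots mod k is a street of its own on which the rule is the 1-vacillating one; for
-- n = k a + b the first b classes have a + 1 spots and the other k − b classes have a spots.
-- Reading preference lists as words accepted by the partial map "park one more car", the count for a
-- union of two independent sets of letters is the binomial convolution (shuffle) of the two counts.
-- A street with m spots accepts no word longer than m, so at length n only the term giving every class
-- exactly as many cars as spots survives: the multinomial coefficient times the product of the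
-- numbers of vacillating parking functions of the class lengths.

module Submission where

open import Data.Bool using (Bool; true; false; T; T?; if_then_else_; not; _∧_; _∨_)
open import Data.Bool.Properties using (T-not-≡; T-∧)
open import Data.List using (List; []; _∷_; _++_; map; length; filterᵇ; concatMap; applyUpTo; upTo; replicate)
open import Data.List.Properties using (map-++; map-cong; map-cong-local; map-∘; length-++; filter-++; filter-≐; map-upTo; map-applyUpTo; ++-assoc; length-replicate; map-replicate)
open import Data.List.Relation.Unary.All as All using (All)
open import Data.List.Relation.Unary.All.Properties using (applyUpTo⁺₁; ++⁺)
open import Data.Maybe using (Maybe; just; nothing; maybe′; is-just)
open import Data.Maybe.Relation.Binary.Pointwise using (Pointwise; just; nothing)
open import Data.Nat
open import Data.Nat.DivMod using ([m+kn]%n≡m%n; m<n⇒m%n≡m; m/n*n≡m; m*n/n≡m; +-distrib-/-∣ʳ; m<n⇒m/n≡0)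
open import Data.Nat.Divisibility using (n∣m*n)
open import Data.Nat.Combinatorics using (_C_; nCk+nC[k+1]≡[n+1]C[k+1]; k>n⇒nCk≡0; nCk≡n!/k![n-k]!; k![n∸k]!∣n!)
open import Data.Nat.ListAction using (sum; product)
open import Data.Nat.ListAction.Properties using (sum-++; product-++)
open import Data.Nat.Properties
open import Algebra.Properties.CommutativeSemigroup +-commutativeSemigroup using (interchange; xy∙z≈xz∙y)
open import Data.Nat.Tactic.RingSolver using (solve-∀)
open import Data.Product using (_×_; _,_; proj₁; proj₂)
open import Data.Unit using (⊤)
open import Data.Vec using (Vec; _∷_)
open import Function using (_∘_; id; _⇔_; mk⇔; Equivalence)
open import Relation.Binary.PropositionalEquality
open import Relation.Nullary using (Reflects; ofʸ; ofⁿ; yes; no; contradiction)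
open import Relation.Nullary.Reflects using (fromEquivalence; det)
open import Relation.Unary using (_≐_)
open ≡-Reasoning

open import Defs

∑< : ℕ → (ℕ → ℕ) → ℕ
∑< zero    f = 0
∑< (suc n) f = f 0 + ∑< n (λ i → f (suc i))

syntax ∑< n (λ i → e) = ∑[ i < n ] e

∑-cong : ∀ n {f g : ℕ → ℕ} → (∀ i → i < n → f i ≡ g i) → ∑< n f ≡ ∑< n g
∑-cong zero    f≡g = refl
∑-cong (suc n) f≡g = cong₂ _+_ (f≡g 0 z<s) (∑-cong n (λ i i<n → f≡g (suc i) (s<s i<n)))

∑-+ : ∀ a b f → ∑< (a + b) f ≡ ∑< a f + ∑[ i < b ] f (a + i)
∑-+ zero    b f = refl
∑-+ (suc a) b f = trans (cong (f 0 +_) (∑-+ a b (λ i → f (suc i)))) (sym (+-assoc (f 0) _ _))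

∑-distrib-+ : ∀ n f g → ∑[ i < n ] (f i + g i) ≡ ∑< n f + ∑< n g
∑-distrib-+ zero    f g = refl
∑-distrib-+ (suc n) f g = trans (cong (f 0 + g 0 +_) (∑-distrib-+ n _ _)) (interchange (f 0) (g 0) _ _)

∑-zero : ∀ n → ∑[ i < n ] 0 ≡ 0
∑-zero zero    = refl
∑-zero (suc n) = ∑-zero n

∑-swap : ∀ a b (F : ℕ → ℕ → ℕ) → ∑[ i < a ] ∑< b (F i) ≡ ∑[ j < b ] ∑[ i < a ] F i j
∑-swap zero    b F = sym (∑-zero b)
∑-swap (suc a) b F = trans (cong (∑< b (F 0) +_) (∑-swap a b (λ i → F (suc i)))) (sym (∑-distrib-+ b (F 0) _))

∑-snoc : ∀ n f → ∑< (suc n) f ≡ ∑< n f + f n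
∑-snoc zero    f = +-comm (f 0) 0
∑-snoc (suc n) f = trans (cong (f 0 +_) (∑-snoc n (λ i → f (suc i)))) (sym (+-assoc (f 0) _ _))

∑-const : ∀ n c → ∑[ i < n ] c ≡ n * c
∑-const zero    c = refl
∑-const (suc n) c = cong (c +_) (∑-const n c)

∑-blocks : ∀ q k f → ∑< (q * k) f ≡ ∑[ p < q ] ∑[ r < k ] f (r + p * k)
∑-blocks zero    k f = refl
∑-blocks (suc q) k f = begin
  ∑< (k + q * k) f                                        ≡⟨ ∑-+ k (q * k) f ⟩
  ∑< k f + ∑[ i < q * k ] f (k + i)                       ≡⟨ cong₂ _+_ (∑-cong k (λ r _ → cong f (sym (+-identityʳ r))))
                                                                       (∑-blocks q k (λ i → f (k + i))) ⟩
  ∑[ r < k ] f (r + 0) + ∑[ p < q ] ∑[ r < k ] f (k + (r + p * k))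
      ≡⟨ cong (∑[ r < k ] f (r + 0) +_) (∑-cong q (λ p _ → ∑-cong k (λ r _ → cong f (x+[y+z]≡y+[x+z] k r (p * k))))) ⟩
  ∑[ r < k ] f (r + 0) + ∑[ p < q ] ∑[ r < k ] f (r + suc p * k) ∎
  where
  x+[y+z]≡y+[x+z] : ∀ x y z → x + (y + z) ≡ y + (x + z)
  x+[y+z]≡y+[x+z] = solve-∀

∑-mono-≤ : ∀ n {f g} → (∀ i → i < n → f i ≤ g i) → ∑< n f ≤ ∑< n g
∑-mono-≤ zero    f≤g = z≤n
∑-mono-≤ (suc n) f≤g = +-mono-≤ (f≤g 0 z<s) (∑-mono-≤ n (λ i i<n → f≤g (suc i) (s<s i<n)))

∑-mono-< : ∀ n {f g} i → i < n → f i < g i → (∀ i → i < n → f i ≤ g i) → ∑< n f < ∑< n g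
∑-mono-< (suc n) zero    _         fi<gi f≤g = +-mono-<-≤ fi<gi (∑-mono-≤ n (λ i i<n → f≤g (suc i) (s<s i<n)))
∑-mono-< (suc n) (suc i) (s<s i<n) fi<gi f≤g =
  +-mono-≤-< (f≤g 0 z<s) (∑-mono-< n i i<n fi<gi (λ i i<n → f≤g (suc i) (s<s i<n)))

∑-residues : ∀ k a b f → b ≤ k →
  ∑< (k * a + b) f ≡ ∑[ r < b ] ∑[ q < suc a ] f (r + q * k) + ∑[ r < k ∸ b ] ∑[ q < a ] f (b + r + q * k)
∑-residues k a b f b≤k = begin
  ∑< (k * a + b) f
    ≡⟨ ∑-+ (k * a) b f ⟩
  ∑< (k * a) f + ∑[ i < b ] f (k * a + i)
    ≡⟨ cong₂ _+_ (trans (cong (λ m → ∑< m f) (*-comm k a)) (trans (∑-blocks a k f) (∑-swap a k _)))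
                 (∑-cong b (λ r _ → cong f (trans (+-comm (k * a) r) (cong (r +_) (*-comm k a))))) ⟩
  ∑[ r < k ] ∑[ q < a ] f (r + q * k) + Z
    ≡⟨ cong (λ m → ∑[ r < m ] ∑[ q < a ] f (r + q * k) + Z) (sym (m+[n∸m]≡n b≤k)) ⟩
  ∑[ r < b + (k ∸ b) ] ∑[ q < a ] f (r + q * k) + Z
    ≡⟨ cong (_+ Z) (∑-+ b (k ∸ b) _) ⟩
  X + Y + Z
    ≡⟨ xy∙z≈xz∙y X Y Z ⟩
  X + Z + Y
    ≡⟨ cong (_+ Y) (sym (∑-distrib-+ b _ _)) ⟩
  ∑[ r < b ] (∑[ q < a ] f (r + q * k) + f (r + a * k)) + Y
    ≡⟨ cong (_+ Y) (∑-cong b (λ r _ → sym (∑-snoc a (λ q → f (r + q * k))))) ⟩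
  ∑[ r < b ] ∑[ q < suc a ] f (r + q * k) + Y ∎
  where
  X Y Z : ℕ
  X = ∑[ r < b ] ∑[ q < a ] f (r + q * k)
  Y = ∑[ r < k ∸ b ] ∑[ q < a ] f (b + r + q * k)
  Z = ∑[ r < b ] f (r + a * k)

sum-map-applyUpTo : ∀ (h f : ℕ → ℕ) n → sum (map h (applyUpTo f n)) ≡ ∑[ i < n ] h (f i)
sum-map-applyUpTo h f zero    = refl
sum-map-applyUpTo h f (suc n) = cong (h (f 0) +_) (sum-map-applyUpTo h (λ i → f (suc i)) n)

sum-map-zero : {A : Set} {f : A → ℕ} (L : List A) → All (λ a → f a ≡ 0) L → sum (map f L) ≡ 0
sum-map-zero []      All.[]            = refl
sum-map-zero (a ∷ L) (fa≡0 All.∷ L≡0) = cong₂ _+_ fa≡0 (sum-map-zero L L≡0)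

sum-replicate : ∀ c x → sum (replicate c x) ≡ c * x
sum-replicate zero    x = refl
sum-replicate (suc c) x = cong (x +_) (sum-replicate c x)

product-replicate : ∀ c x → product (replicate c x) ≡ x ^ c
product-replicate zero    x = refl
product-replicate (suc c) x = cong (x *_) (product-replicate c x)

applyUpTo-+ : {A : Set} (f : ℕ → A) (m n : ℕ) → applyUpTo f (m + n) ≡ applyUpTo f m ++ applyUpTo (λ i → f (m + i)) n
applyUpTo-+ f zero    n = refl
applyUpTo-+ f (suc m) n = cong (f 0 ∷_) (applyUpTo-+ (λ i → f (suc i)) m n)

applyUpTo-const : {A : Set} {f : ℕ → A} {x : A} (n : ℕ) → (∀ i → i < n → f i ≡ x) → applyUpTo f n ≡ replicate n x
applyUpTo-const zero    f≡x = refl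
applyUpTo-const (suc n) f≡x = cong₂ _∷_ (f≡x 0 z<s) (applyUpTo-const n (λ i i<n → f≡x (suc i) (s<s i<n)))

module _ {A : Set} (p : A → Bool) where

  length-filterᵇ-concatMap : {B : Set} (f : B → List A) (xs : List B) →
                             length (filterᵇ p (concatMap f xs)) ≡ sum (map (λ x → length (filterᵇ p (f x))) xs)
  length-filterᵇ-concatMap f []       = refl
  length-filterᵇ-concatMap f (x ∷ xs) = begin
    length (filterᵇ p (f x ++ concatMap f xs))                    ≡⟨ cong length (filter-++ (T? ∘ p) (f x) _) ⟩
    length (filterᵇ p (f x) ++ filterᵇ p (concatMap f xs))        ≡⟨ length-++ (filterᵇ p (f x)) ⟩
    length (filterᵇ p (f x)) + length (filterᵇ p (concatMap f xs)) ≡⟨ cong (length (filterᵇ p (f x)) +_) (length-filterᵇ-concatMap f xs) ⟩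
    sum (map (λ x → length (filterᵇ p (f x))) (x ∷ xs))            ∎

  length-filterᵇ-map : {B : Set} (g : B → A) (ys : List B) → length (filterᵇ p (map g ys)) ≡ length (filterᵇ (p ∘ g) ys)
  length-filterᵇ-map g []       = refl
  length-filterᵇ-map g (y ∷ ys) with p (g y)
  ... | true  = cong suc (length-filterᵇ-map g ys)
  ... | false = length-filterᵇ-map g ys

length-filterᵇ-false : {A : Set} (xs : List A) → length (filterᵇ (λ _ → false) xs) ≡ 0
length-filterᵇ-false []       = refl
length-filterᵇ-false (x ∷ xs) = length-filterᵇ-false xs

-- Shuffle products and binomial coefficients

-- shuffle m F G = ∑_{i+j=m} (m C i) F i G j: the number of interleavings of a word counted by F with one counted by G.
shuffle : ℕ → (ℕ → ℕ) → (ℕ → ℕ) → ℕ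
shuffle zero    F G = F 0 * G 0
shuffle (suc m) F G = shuffle m (λ i → F (suc i)) G + shuffle m F (λ j → G (suc j))

shuffle-cong : ∀ m {F F′ G G′} → (∀ i → F i ≡ F′ i) → (∀ j → G j ≡ G′ j) → shuffle m F G ≡ shuffle m F′ G′
shuffle-cong zero    F≡F′ G≡G′ = cong₂ _*_ (F≡F′ 0) (G≡G′ 0)
shuffle-cong (suc m) F≡F′ G≡G′ = cong₂ _+_ (shuffle-cong m (λ i → F≡F′ (suc i)) G≡G′) (shuffle-cong m F≡F′ (λ j → G≡G′ (suc j)))

shuffle-zeroˡ : ∀ m {F} G → (∀ i → F i ≡ 0) → shuffle m F G ≡ 0
shuffle-zeroˡ zero    G F≡0 = cong (_* G 0) (F≡0 0)
shuffle-zeroˡ (suc m) G F≡0 = cong₂ _+_ (shuffle-zeroˡ m G (λ i → F≡0 (suc i))) (shuffle-zeroˡ m _ F≡0)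

shuffle-zeroʳ : ∀ m F {G} → (∀ j → G j ≡ 0) → shuffle m F G ≡ 0
shuffle-zeroʳ zero    F G≡0 = trans (cong (F 0 *_) (G≡0 0)) (*-zeroʳ (F 0))
shuffle-zeroʳ (suc m) F G≡0 = cong₂ _+_ (shuffle-zeroʳ m _ G≡0) (shuffle-zeroʳ m F (λ j → G≡0 (suc j)))

shuffle-+ˡ : ∀ m F F′ G → shuffle m (λ i → F i + F′ i) G ≡ shuffle m F G + shuffle m F′ G
shuffle-+ˡ zero    F F′ G = *-distribʳ-+ (G 0) (F 0) (F′ 0)
shuffle-+ˡ (suc m) F F′ G =
  trans (cong₂ _+_ (shuffle-+ˡ m _ _ G) (shuffle-+ˡ m F F′ (G ∘ suc))) (interchange (shuffle m (F ∘ suc) G) _ _ _)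

shuffle-+ʳ : ∀ m F G G′ → shuffle m F (λ j → G j + G′ j) ≡ shuffle m F G + shuffle m F G′
shuffle-+ʳ zero    F G G′ = *-distribˡ-+ (F 0) (G 0) (G′ 0)
shuffle-+ʳ (suc m) F G G′ =
  trans (cong₂ _+_ (shuffle-+ʳ m (F ∘ suc) G G′) (shuffle-+ʳ m F _ _)) (interchange (shuffle m (F ∘ suc) G) _ _ _)

module _ {A : Set} where

  shuffle-sumˡ : ∀ m (L : List A) (F : A → ℕ → ℕ) G →
                 shuffle m (λ i → sum (map (λ a → F a i) L)) G ≡ sum (map (λ a → shuffle m (F a) G) L)
  shuffle-sumˡ m []      F G = shuffle-zeroˡ m G (λ _ → refl)
  shuffle-sumˡ m (a ∷ L) F G = trans (shuffle-+ˡ m (F a) _ G) (cong (shuffle m (F a) G +_) (shuffle-sumˡ m L F G))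

  shuffle-sumʳ : ∀ m (L : List A) F (G : A → ℕ → ℕ) →
                 shuffle m F (λ j → sum (map (λ a → G a j) L)) ≡ sum (map (λ a → shuffle m F (G a)) L)
  shuffle-sumʳ m []      F G = shuffle-zeroʳ m F (λ _ → refl)
  shuffle-sumʳ m (a ∷ L) F G = trans (shuffle-+ʳ m F (G a) _) (cong (shuffle m F (G a) +_) (shuffle-sumʳ m L F G))

module _ {Y : Set} where

  shuffle-maybeˡ : ∀ m (my : Maybe Y) (F : Y → ℕ → ℕ) G →
                   maybe′ (λ y → shuffle m (F y) G) 0 my ≡ shuffle m (λ i → maybe′ (λ y → F y i) 0 my) G
  shuffle-maybeˡ m (just y) F G = refl
  shuffle-maybeˡ m nothing  F G = sym (shuffle-zeroˡ m G (λ _ → refl))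

  shuffle-maybeʳ : ∀ m (my : Maybe Y) F (G : Y → ℕ → ℕ) →
                   maybe′ (λ y → shuffle m F (G y)) 0 my ≡ shuffle m F (λ j → maybe′ (λ y → G y j) 0 my)
  shuffle-maybeʳ m (just y) F G = refl
  shuffle-maybeʳ m nothing  F G = sym (shuffle-zeroʳ m F (λ _ → refl))

VanishesAbove : ℕ → (ℕ → ℕ) → Set
VanishesAbove a F = ∀ x → F (suc a + x) ≡ 0

shuffle-vanishes : ∀ a b {F G} → VanishesAbove a F → VanishesAbove b G → VanishesAbove (a + b) (λ m → shuffle m F G)
shuffle-vanishes zero zero F↑ G↑ x =
  cong₂ _+_ (shuffle-zeroˡ x _ F↑) (shuffle-zeroʳ x _ G↑)
shuffle-vanishes zero (suc b) F↑ G↑ x =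
  cong₂ _+_ (shuffle-zeroˡ (suc b + x) _ F↑) (shuffle-vanishes zero b F↑ G↑ x)
shuffle-vanishes (suc a) zero {F} {G} F↑ G↑ x =
  cong₂ _+_ (shuffle-vanishes a zero F↑ G↑ x) (shuffle-zeroʳ (suc a + 0 + x) F G↑)
shuffle-vanishes (suc a) (suc b) {F} {G} F↑ G↑ x =
  cong₂ _+_ (shuffle-vanishes a (suc b) F↑ G↑ x)
            (subst (λ m → shuffle m F (λ j → G (suc j)) ≡ 0) (cong (λ c → suc (c + x)) (sym (+-suc a b))) (shuffle-vanishes (suc a) b F↑ G↑ x))

*-distribʳ-+₂ : ∀ p q x y → (p + q) * x * y ≡ p * x * y + q * x * y
*-distribʳ-+₂ = solve-∀

shuffle-top : ∀ a b {F G} → VanishesAbove a F → VanishesAbove b G → shuffle (a + b) F G ≡ ((a + b) C a) * F a * G b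
shuffle-top zero    zero    {F} {G} F↑ G↑ = cong (_* G 0) (sym (+-identityʳ (F 0)))
shuffle-top zero    (suc b) {F} {G} F↑ G↑ = begin
  shuffle b (λ i → F (suc i)) G + shuffle b F (λ j → G (suc j)) ≡⟨ cong₂ _+_ (shuffle-zeroˡ b G F↑) (shuffle-top zero b F↑ G↑) ⟩
  (b C 0) * F 0 * G (suc b)                                         ∎
shuffle-top (suc a) zero    {F} {G} F↑ G↑ = begin
  shuffle (a + 0) (λ i → F (suc i)) G + shuffle (a + 0) F (λ j → G (suc j))
    ≡⟨ cong₂ _+_ (shuffle-top a zero F↑ G↑) (shuffle-zeroʳ (a + 0) F G↑) ⟩
  ((a + 0) C a) * F (suc a) * G 0 + 0
    ≡⟨ cong (λ c → ((a + 0) C a) * F (suc a) * G 0 + c * F (suc a) * G 0) (sym (k>n⇒nCk≡0 a<1+a+0)) ⟩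
  ((a + 0) C a) * F (suc a) * G 0 + ((a + 0) C suc a) * F (suc a) * G 0
    ≡⟨ sym (*-distribʳ-+₂ ((a + 0) C a) _ (F (suc a)) (G 0)) ⟩
  (((a + 0) C a) + ((a + 0) C suc a)) * F (suc a) * G 0
    ≡⟨ cong (λ c → c * F (suc a) * G 0) (nCk+nC[k+1]≡[n+1]C[k+1] (a + 0) a) ⟩
  (suc (a + 0) C suc a) * F (suc a) * G 0 ∎
  where
  a<1+a+0 : a + 0 < suc a
  a<1+a+0 = s≤s (≤-reflexive (+-identityʳ a))
shuffle-top (suc a) (suc b) {F} {G} F↑ G↑ = begin
  shuffle (a + suc b) (λ i → F (suc i)) G + shuffle (a + suc b) F (λ j → G (suc j))
    ≡⟨ cong₂ _+_ (shuffle-top a (suc b) F↑ G↑)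
                 (trans (cong (λ m → shuffle m F (λ j → G (suc j))) (+-suc a b)) (shuffle-top (suc a) b F↑ G↑)) ⟩
  ((a + suc b) C a) * F (suc a) * G (suc b) + (suc (a + b) C suc a) * F (suc a) * G (suc b)
    ≡⟨ cong (λ m → ((a + suc b) C a) * F (suc a) * G (suc b) + (m C suc a) * F (suc a) * G (suc b)) (sym (+-suc a b)) ⟩
  ((a + suc b) C a) * F (suc a) * G (suc b) + ((a + suc b) C suc a) * F (suc a) * G (suc b)
    ≡⟨ sym (*-distribʳ-+₂ (((a + suc b) C a)) _ (F (suc a)) (G (suc b))) ⟩
  (((a + suc b) C a) + ((a + suc b) C suc a)) * F (suc a) * G (suc b)
    ≡⟨ cong (λ c → c * F (suc a) * G (suc b)) (nCk+nC[k+1]≡[n+1]C[k+1] (a + suc b) a) ⟩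
  (suc (a + suc b) C suc a) * F (suc a) * G (suc b) ∎

multinomial : List ℕ → ℕ
multinomial []       = 1
multinomial (m ∷ ms) = ((m + sum ms) C m) * multinomial ms

C-factorials : ∀ a b → ((a + b) C a) * (a ! * b !) ≡ (a + b) !
C-factorials a b = begin
  ((a + b) C a) * (a ! * b !)                                    ≡⟨ cong (λ c → ((a + b) C a) * (a ! * c !)) (sym (m+n∸m≡n a b)) ⟩
  ((a + b) C a) * (a ! * (a + b ∸ a) !)                          ≡⟨ cong (_* (a ! * (a + b ∸ a) !)) (nCk≡n!/k![n-k]! a≤a+b) ⟩
  ((a + b) ! / (a ! * (a + b ∸ a) !)) * (a ! * (a + b ∸ a) !)    ≡⟨ m/n*n≡m (k![n∸k]!∣n! a≤a+b) ⟩
  (a + b) !                                                      ∎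
  where
  a≤a+b : a ≤ a + b
  a≤a+b = m≤m+n a b
  instance _ = a !* (a + b ∸ a) !≢0

multinomial-factorials : ∀ ms → multinomial ms * product (map _! ms) ≡ sum ms !
multinomial-factorials []       = refl
multinomial-factorials (m ∷ ms) = begin
  ((m + sum ms) C m) * multinomial ms * (m ! * product (map _! ms)) ≡⟨ rearrange ((m + sum ms) C m) (multinomial ms) (m !) _ ⟩
  ((m + sum ms) C m) * (m ! * (multinomial ms * product (map _! ms))) ≡⟨ cong (λ p → ((m + sum ms) C m) * (m ! * p)) (multinomial-factorials ms) ⟩
  ((m + sum ms) C m) * (m ! * sum ms !)                               ≡⟨ C-factorials m (sum ms) ⟩
  (m + sum ms) !                                                      ∎
  where
  rearrange : ∀ c b f p → c * b * (f * p) ≡ c * (f * (b * p))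
  rearrange = solve-∀

maybe′-Pointwise : {X Y : Set} {R : X → Y → Set} {f : X → ℕ} {g : Y → ℕ} {mx : Maybe X} {my : Maybe Y} →
                   (∀ {x y} → R x y → f x ≡ g y) → Pointwise R mx my → maybe′ f 0 mx ≡ maybe′ g 0 my
maybe′-Pointwise f≡g (just r) = f≡g r
maybe′-Pointwise f≡g nothing  = refl

maybe′-cong : {X : Set} {f g : X → ℕ} → (∀ x → f x ≡ g x) → ∀ mx → maybe′ f 0 mx ≡ maybe′ g 0 mx
maybe′-cong f≡g (just x) = f≡g x
maybe′-cong f≡g nothing  = refl

accepted : {X A : Set} → (X → A → Maybe X) → List A → X → ℕ → ℕ
accepted step L x zero    = 1
accepted step L x (suc m) = sum (map (λ a → maybe′ (λ x′ → accepted step L x′ m) 0 (step x a)) L)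

module _ {X A : Set} (step : X → A → Maybe X) where

  accepted-cong : ∀ {L L′ : List A} → (∀ g → sum (map g L) ≡ sum (map g L′)) → ∀ m x → accepted step L x m ≡ accepted step L′ x m
  accepted-cong         sums zero    x = refl
  accepted-cong {L} {L′} sums (suc m) x = begin
    sum (map (λ a → maybe′ (λ x′ → accepted step L x′ m) 0 (step x a)) L)
      ≡⟨ cong sum (map-cong (λ a → maybe′-cong (λ x′ → accepted-cong sums m x′) (step x a)) L) ⟩
    sum (map (λ a → maybe′ (λ x′ → accepted step L′ x′ m) 0 (step x a)) L)
      ≡⟨ sums _ ⟩
    sum (map (λ a → maybe′ (λ x′ → accepted step L′ x′ m) 0 (step x a)) L′) ∎

  accepted-capacity : (μ : X → ℕ) {L : List A} → All (λ a → ∀ {x x′} → step x a ≡ just x′ → μ x′ < μ x) L →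
                      ∀ m x → μ x < m → accepted step L x m ≡ 0
  accepted-capacity μ {L} decreasing (suc m) x (s≤s μx≤m) = sum-map-zero L (All.map stuck decreasing)
    where
    stuck : ∀ {a} → (∀ {x x′} → step x a ≡ just x′ → μ x′ < μ x) → maybe′ (λ x′ → accepted step L x′ m) 0 (step x a) ≡ 0
    stuck {a} dec with step x a in eq
    ... | nothing = refl
    ... | just x′ = accepted-capacity μ decreasing m x′ (<-≤-trans (dec eq) μx≤m)

module _ {X Y A B I : Set} (R : X → Y → Set) (stepX : X → A → Maybe X) (stepY : Y → B → Maybe Y)
         (e : I → A) (e′ : I → B) (simulates : ∀ {x y} i → R x y → Pointwise R (stepX x (e i)) (stepY y (e′ i))) where

  accepted-simulation : ∀ (L : List I) m {x y} → R x y → accepted stepX (map e L) x m ≡ accepted stepY (map e′ L) y m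
  accepted-simulation L zero    r = refl
  accepted-simulation L (suc m) {x} {y} r = begin
    sum (map (λ a → maybe′ (λ x′ → accepted stepX (map e L) x′ m) 0 (stepX x a)) (map e L))
      ≡⟨ cong sum (sym (map-∘ L)) ⟩
    sum (map (λ i → maybe′ (λ x′ → accepted stepX (map e L) x′ m) 0 (stepX x (e i))) L)
      ≡⟨ cong sum (map-cong (λ i → maybe′-Pointwise (accepted-simulation L m) (simulates i r)) L) ⟩
    sum (map (λ i → maybe′ (λ y′ → accepted stepY (map e′ L) y′ m) 0 (stepY y (e′ i))) L)
      ≡⟨ cong sum (map-∘ L) ⟩
    sum (map (λ b → maybe′ (λ y′ → accepted stepY (map e′ L) y′ m) 0 (stepY y b)) (map e′ L)) ∎

module _ {X Y Z A : Set} (R : X → Y → Z → Set)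
         (stepX : X → A → Maybe X) (stepY : Y → A → Maybe Y) (stepZ : Z → A → Maybe Z) {LY LZ : List A}
         (onY : All (λ a → ∀ {x y z} → R x y z → Pointwise (λ x′ y′ → R x′ y′ z) (stepX x a) (stepY y a)) LY)
         (onZ : All (λ a → ∀ {x y z} → R x y z → Pointwise (λ x′ z′ → R x′ y z′) (stepX x a) (stepZ z a)) LZ) where

  accepted-++ : ∀ m {x y z} → R x y z →
                accepted stepX (LY ++ LZ) x m ≡ shuffle m (accepted stepY LY y) (accepted stepZ LZ z)
  accepted-++ zero    r = refl
  accepted-++ (suc m) {x} {y} {z} r = begin
    sum (map f (LY ++ LZ))
      ≡⟨ trans (cong sum (map-++ f LY LZ)) (sum-++ (map f LY) (map f LZ)) ⟩
    sum (map f LY) + sum (map f LZ)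
      ≡⟨ cong₂ _+_ (cong sum (map-cong-local (All.map (λ sim → maybe′-Pointwise (λ r′ → accepted-++ m r′) (sim r)) onY)))
                   (cong sum (map-cong-local (All.map (λ sim → maybe′-Pointwise (λ r′ → accepted-++ m r′) (sim r)) onZ))) ⟩
    sum (map (λ a → maybe′ (λ y′ → shuffle m (accepted stepY LY y′) (accepted stepZ LZ z)) 0 (stepY y a)) LY)
      + sum (map (λ a → maybe′ (λ z′ → shuffle m (accepted stepY LY y) (accepted stepZ LZ z′)) 0 (stepZ z a)) LZ)
      ≡⟨ cong₂ _+_ (cong sum (map-cong (λ a → shuffle-maybeˡ m (stepY y a) _ _) LY))
                   (cong sum (map-cong (λ a → shuffle-maybeʳ m (stepZ z a) _ _) LZ)) ⟩
    sum (map (λ a → shuffle m (λ i → maybe′ (λ y′ → accepted stepY LY y′ i) 0 (stepY y a)) (accepted stepZ LZ z)) LY)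
      + sum (map (λ a → shuffle m (accepted stepY LY y) (λ j → maybe′ (λ z′ → accepted stepZ LZ z′ j) 0 (stepZ z a))) LZ)
      ≡⟨ sym (cong₂ _+_ (shuffle-sumˡ m LY _ (accepted stepZ LZ z)) (shuffle-sumʳ m LZ (accepted stepY LY y) _)) ⟩
    shuffle (suc m) (accepted stepY LY y) (accepted stepZ LZ z) ∎
    where
    f : A → ℕ
    f a = maybe′ (λ x′ → accepted stepX (LY ++ LZ) x′ m) 0 (stepX x a)

-- Vacillating parking functions as accepted words

module _ (n k : ℕ) where

  parkingCount : List ℕ → ℕ → ℕ
  parkingCount occ m = length (filterᵇ (λ α → is-just (parkAll n k occ α)) (prefLists n m))

  parkingCount-∷ : ∀ occ a m → length (filterᵇ (λ α → is-just (parkAll n k occ (a ∷ α))) (prefLists n m))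
                                ≡ maybe′ (λ occ′ → parkingCount occ′ m) 0 (parkCar n k occ a)
  parkingCount-∷ occ a m with parkCar n k occ a
  ... | nothing   = length-filterᵇ-false (prefLists n m)
  ... | just occ′ = refl

  parkingCount≡accepted : ∀ m occ → parkingCount occ m ≡ accepted (parkCar n k) (applyUpTo suc n) occ m
  parkingCount≡accepted zero    occ = refl
  parkingCount≡accepted (suc m) occ = begin
    length (filterᵇ parks (concatMap (λ i → map (suc i ∷_) (prefLists n m)) (upTo n)))
      ≡⟨ length-filterᵇ-concatMap parks _ (upTo n) ⟩
    sum (map (λ i → length (filterᵇ parks (map (suc i ∷_) (prefLists n m)))) (upTo n))
      ≡⟨ cong sum (map-cong (λ i → trans (length-filterᵇ-map parks (suc i ∷_) (prefLists n m)) (parkingCount-∷ occ (suc i) m)) (upTo n)) ⟩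
    sum (map (λ i → maybe′ (λ occ′ → parkingCount occ′ m) 0 (parkCar n k occ (suc i))) (upTo n))
      ≡⟨ cong sum (map-cong (λ i → maybe′-cong (λ occ′ → parkingCount≡accepted m occ′) (parkCar n k occ (suc i))) (upTo n)) ⟩
    sum (map (λ i → maybe′ (λ occ′ → accepted (parkCar n k) (applyUpTo suc n) occ′ m) 0 (parkCar n k occ (suc i))) (upTo n))
      ≡⟨ cong sum (trans (map-upTo _ n) (sym (map-applyUpTo suc _ n))) ⟩
    accepted (parkCar n k) (applyUpTo suc n) occ (suc m) ∎
    where
    parks : Vec ℕ (suc m) → Bool
    parks α = is-just (parkAll n k occ α)

  vpfCount≡accepted : vpfCount n k ≡ accepted (parkCar n k) (applyUpTo suc n) [] n
  vpfCount≡accepted = trans (cong length (filter-≐ (T? ∘ isVPF n k) (T? ∘ parks) isVPF≐parks (prefLists n n)))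
                            (parkingCount≡accepted n [])
    where
    parks : Vec ℕ n → Bool
    parks α = is-just (parkAll n k [] α)
    isVPF≡parks : ∀ α → isVPF n k α ≡ parks α
    isVPF≡parks α with parkAll n k [] α
    ... | just _  = refl
    ... | nothing = refl
    isVPF≐parks : (T ∘ isVPF n k) ≐ (T ∘ parks)
    isVPF≐parks = (λ {α} → subst T (isVPF≡parks α)) , (λ {α} → subst T (sym (isVPF≡parks α)))

spot : (k j q : ℕ) → ℕ
spot k j q = suc (j + q * k)

spot-suc : ∀ k j q → spot k j (suc q) ≡ k + spot k j q
spot-suc k j q = lemma k j q
  where
  lemma : ∀ k j q → suc (j + (k + q * k)) ≡ k + suc (j + q * k)
  lemma = solve-∀

spot-injective : ∀ {k j r q q′} → j < k → r < k → spot k j q ≡ spot k r q′ → j ≡ r × q ≡ q′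
spot-injective {suc _} {j} {r} {q} {q′} j<k r<k eq = j≡r , q≡q′
  where
  k : ℕ
  k = suc _
  j≡r : j ≡ r
  j≡r = begin
    j                ≡⟨ sym (m<n⇒m%n≡m j<k) ⟩
    j % k            ≡⟨ sym ([m+kn]%n≡m%n j q k) ⟩
    (j + q * k) % k  ≡⟨ cong (λ s → pred s % k) eq ⟩
    (r + q′ * k) % k ≡⟨ [m+kn]%n≡m%n r q′ k ⟩
    r % k            ≡⟨ m<n⇒m%n≡m r<k ⟩
    r                ∎
  q≡q′ : q ≡ q′
  q≡q′ = *-cancelʳ-≡ q q′ k (+-cancelˡ-≡ j _ _ (trans (suc-injective eq) (cong (_+ q′ * k) (sym j≡r))))

≡ᵇ-reflects-≡ : ∀ m n → Reflects (m ≡ n) (m ≡ᵇ n)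
≡ᵇ-reflects-≡ m n = fromEquivalence (≡ᵇ⇒≡ m n) (≡⇒≡ᵇ m n)

spot-≡ᵇ-same : ∀ {k j} q q′ → j < k → (spot k j q ≡ᵇ spot k j q′) ≡ (q ≡ᵇ q′)
spot-≡ᵇ-same {k} {j} q q′ j<k = det
  (fromEquivalence (proj₂ ∘ spot-injective {q = q} {q′} j<k j<k ∘ ≡ᵇ⇒≡ _ _) (≡⇒≡ᵇ _ _ ∘ cong (spot k j)))
  (≡ᵇ-reflects-≡ q q′)

spot-≡ᵇ-other : ∀ {k j r} q q′ → j < k → r < k → j ≢ r → (spot k j q ≡ᵇ spot k r q′) ≡ false
spot-≡ᵇ-other q q′ j<k r<k j≢r = det (≡ᵇ-reflects-≡ _ _) (ofⁿ (j≢r ∘ proj₁ ∘ spot-injective {q = q} {q′} j<k r<k))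

firstAvailable : {A : Set} → Bool → A → Bool → A → Bool → A → Maybe A
firstAvailable c₁ x₁ c₂ x₂ c₃ x₃ = if c₁ then just x₁ else if c₂ then just x₂ else if c₃ then just x₃ else nothing

firstAvailable-just : {A : Set} (P : A → Set) (c₁ : Bool) {x₁ : A} (c₂ : Bool) {x₂ : A} (c₃ : Bool) {x₃ x : A} →
  firstAvailable c₁ x₁ c₂ x₂ c₃ x₃ ≡ just x → (T c₁ → P x₁) → (T c₂ → P x₂) → (T c₃ → P x₃) → P x
firstAvailable-just P true  _     _    refl p₁ p₂ p₃ = p₁ _
firstAvailable-just P false true  _    refl p₁ p₂ p₃ = p₂ _
firstAvailable-just P false false true refl p₁ p₂ p₃ = p₃ _

module _ {A B : Set} (R : A → B → Set) where

  firstAvailable-Pointwise : ∀ {c₁ c₂ c₃ c₁′ c₂′ c₃′ x₁ x₂ x₃ y₁ y₂ y₃} → c₁ ≡ c₁′ → c₂ ≡ c₂′ → c₃ ≡ c₃′ →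
    R x₁ y₁ → R x₂ y₂ → R x₃ y₃ →
    Pointwise R (firstAvailable c₁ x₁ c₂ x₂ c₃ x₃) (firstAvailable c₁′ y₁ c₂′ y₂ c₃′ y₃)
  firstAvailable-Pointwise {true}                  refl refl refl r₁ r₂ r₃ = just r₁
  firstAvailable-Pointwise {false} {true}          refl refl refl r₁ r₂ r₃ = just r₂
  firstAvailable-Pointwise {false} {false} {true}  refl refl refl r₁ r₂ r₃ = just r₃
  firstAvailable-Pointwise {false} {false} {false} refl refl refl r₁ r₂ r₃ = nothing

module _ (n : ℕ) {k j : ℕ} (occ : List ℕ) (j<k : j < k) where

  private
    view : ℕ → Bool → ℕ → ℕ → Maybe (List ℕ)
    view a b l r = firstAvailable (not (occupied occ a)) (a ∷ occ) (b ∧ not (occupied occ l)) (l ∷ occ)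
                                  ((r ≤ᵇ n) ∧ not (occupied occ r)) (r ∷ occ)

    +k≡next : ∀ q → spot k j q + k ≡ spot k j (suc q)
    +k≡next q = trans (+-comm (spot k j q) k) (sym (spot-suc k j q))

  parkCar-spot : ∀ q →
    parkCar n k occ (spot k j q) ≡
    firstAvailable (not (occupied occ (spot k j q)))                                  (spot k j q ∷ occ)
                   ((0 <ᵇ q) ∧ not (occupied occ (spot k j (pred q))))                (spot k j (pred q) ∷ occ)
                   ((spot k j (suc q) ≤ᵇ n) ∧ not (occupied occ (spot k j (suc q)))) (spot k j (suc q) ∷ occ)
  parkCar-spot zero = cong₂ (λ b r → view (spot k j 0) b (spot k j 0 ∸ k) r) k≮spot₀ (+k≡next 0)
    where
    k≮spot₀ : (k <ᵇ spot k j 0) ≡ false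
    k≮spot₀ = det (<ᵇ-reflects-< k (spot k j 0)) (ofⁿ (≤⇒≯ (subst (_≤ k) (cong suc (sym (+-identityʳ j))) j<k)))
  parkCar-spot (suc q) =
    trans (cong₂ (λ b l → view a b l (a + k)) k<spot (trans (cong (_∸ k) (spot-suc k j q)) (m+n∸m≡n k (spot k j q))))
          (cong (view a true (spot k j q)) (+k≡next (suc q)))
    where
    a : ℕ
    a = spot k j (suc q)
    k<spot : (k <ᵇ a) ≡ true
    k<spot = det (<ᵇ-reflects-< k a) (ofʸ (subst (k <_) (sym (spot-suc k j q)) (m<m+n k z<s)))

  parkCar-spot-just : ∀ q (P : List ℕ → Set) {occ′} → parkCar n k occ (spot k j q) ≡ just occ′ →
    (occupied occ (spot k j q) ≡ false → P (spot k j q ∷ occ)) →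
    (occupied occ (spot k j (pred q)) ≡ false → P (spot k j (pred q) ∷ occ)) →
    (spot k j (suc q) ≤ n → occupied occ (spot k j (suc q)) ≡ false → P (spot k j (suc q) ∷ occ)) →
    P occ′
  parkCar-spot-just q P parked here left right =
    firstAvailable-just P (not (occupied occ (spot k j q))) ((0 <ᵇ q) ∧ not (occupied occ (spot k j (pred q))))
                          ((spot k j (suc q) ≤ᵇ n) ∧ not (occupied occ (spot k j (suc q))))
      (trans (sym (parkCar-spot q)) parked)
      (here ∘ Equivalence.to T-not-≡)
      (left ∘ Equivalence.to T-not-≡ ∘ proj₂ ∘ Equivalence.to T-∧)
      (λ c → let inRange , free = Equivalence.to T-∧ c in right (≤ᵇ⇒≤ _ n inRange) (Equivalence.to T-not-≡ free))

ClassSize : (n k j m : ℕ) → Set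
ClassSize n k j m = ∀ q → spot k j q ≤ n ⇔ q < m

classSize-≤ᵇ : ∀ {n k j m} → ClassSize n k j m → ∀ q → (spot k j q ≤ᵇ n) ≡ (q <ᵇ m)
classSize-≤ᵇ {n} {k} {j} {m} size q =
  det (fromEquivalence (Equivalence.to (size q) ∘ ≤ᵇ⇒≤ _ n) (≤⇒≤ᵇ ∘ Equivalence.from (size q))) (<ᵇ-reflects-< q m)

module _ {n k j n′ k′ j′ : ℕ} (j<k : j < k) (j′<k′ : j′ < k′) (sameRange : ∀ q → (spot k j q ≤ᵇ n) ≡ (spot k′ j′ q ≤ᵇ n′)) where

  parkCar-Pointwise : (R : List ℕ → List ℕ → Set) {occ occ′ : List ℕ} →
    (∀ q → occupied occ (spot k j q) ≡ occupied occ′ (spot k′ j′ q)) →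
    (∀ q → R (spot k j q ∷ occ) (spot k′ j′ q ∷ occ′)) →
    ∀ q → Pointwise R (parkCar n k occ (spot k j q)) (parkCar n′ k′ occ′ (spot k′ j′ q))
  parkCar-Pointwise R {occ} {occ′} sameOcc R∷ q =
    subst₂ (Pointwise R) (sym (parkCar-spot n occ j<k q)) (sym (parkCar-spot n′ occ′ j′<k′ q))
      (firstAvailable-Pointwise R (cong not (sameOcc q))
                                  (cong (λ b → (0 <ᵇ q) ∧ not b) (sameOcc (pred q)))
                                  (cong₂ (λ b b′ → b ∧ not b′) (sameRange (suc q)) (sameOcc (suc q)))
                                  (R∷ q) (R∷ (pred q)) (R∷ (suc q)))

-- A residue class is a 1-vacillating street

vpf₁ : ℕ → ℕ → ℕ
vpf₁ m x = accepted (parkCar m 1) (applyUpTo (spot 1 0) m) [] x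

vpf₁≡vpfCount1 : ∀ m → vpf₁ m m ≡ vpfCount1 m
vpf₁≡vpfCount1 zero    = refl
vpf₁≡vpfCount1 (suc m) = begin
  accepted (parkCar (suc m) 1) (applyUpTo (spot 1 0) (suc m)) [] (suc m)
    ≡⟨ cong (λ L → accepted (parkCar (suc m) 1) L [] (suc m)) spots≡suc ⟩
  accepted (parkCar (suc m) 1) (applyUpTo suc (suc m)) [] (suc m)
    ≡⟨ sym (vpfCount≡accepted (suc m) 1) ⟩
  vpfCount1 (suc m) ∎
  where
  spots≡suc : applyUpTo (spot 1 0) (suc m) ≡ applyUpTo suc (suc m)
  spots≡suc = begin
    applyUpTo (spot 1 0) (suc m) ≡⟨ sym (map-upTo (spot 1 0) (suc m)) ⟩
    map (spot 1 0) (upTo (suc m)) ≡⟨ map-cong (λ q → cong suc (*-identityʳ q)) (upTo (suc m)) ⟩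
    map suc (upTo (suc m))        ≡⟨ map-upTo suc (suc m) ⟩
    applyUpTo suc (suc m)         ∎

classSize-street : ∀ m → ClassSize m 1 0 m
classSize-street m q = subst (λ s → suc s ≤ m ⇔ q < m) (sym (*-identityʳ q)) (mk⇔ id id)

accepted-class : ∀ {n k j m} → j < k → ClassSize n k j m → ∀ x → accepted (parkCar n k) (applyUpTo (spot k j) m) [] x ≡ vpf₁ m x
accepted-class {n} {k} {j} {m} j<k size x = begin
  accepted (parkCar n k) (applyUpTo (spot k j) m) [] x   ≡⟨ cong (λ L → accepted (parkCar n k) L [] x) (sym (map-upTo (spot k j) m)) ⟩
  accepted (parkCar n k) (map (spot k j) (upTo m)) [] x  ≡⟨ accepted-simulation SameClass (parkCar n k) (parkCar m 1) (spot k j) (spot 1 0) (λ {occ} {occ′} → simulates {occ} {occ′}) (upTo m) x (λ _ → refl) ⟩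
  accepted (parkCar m 1) (map (spot 1 0) (upTo m)) [] x  ≡⟨ cong (λ L → accepted (parkCar m 1) L [] x) (map-upTo (spot 1 0) m) ⟩
  vpf₁ m x                                               ∎
  where
  sameRange : ∀ q → (spot k j q ≤ᵇ n) ≡ (spot 1 0 q ≤ᵇ m)
  sameRange q = trans (classSize-≤ᵇ size q) (sym (classSize-≤ᵇ (classSize-street m) q))
  SameClass : List ℕ → List ℕ → Set
  SameClass occ occ′ = ∀ q → occupied occ (spot k j q) ≡ occupied occ′ (spot 1 0 q)
  simulates : ∀ {occ occ′} q → SameClass occ occ′ → Pointwise SameClass (parkCar n k occ (spot k j q)) (parkCar m 1 occ′ (spot 1 0 q))
  simulates {occ} {occ′} q same = parkCar-Pointwise {n = n} {n′ = m} j<k z<s sameRange SameClass {occ} {occ′} same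
    (λ q q′ → cong₂ _∨_ (trans (spot-≡ᵇ-same q q′ j<k) (sym (spot-≡ᵇ-same q q′ z<s))) (same q′)) q

freeSpots : ℕ → List ℕ → ℕ
freeSpots m occ = ∑[ q < m ] (if occupied occ (spot 1 0 q) then 0 else 1)

freeSpots-∷ : ∀ m occ q → q < m → occupied occ (spot 1 0 q) ≡ false → freeSpots m (spot 1 0 q ∷ occ) < freeSpots m occ
freeSpots-∷ m occ q q<m free = ∑-mono-< m q q<m takesFree (λ i _ → fewer (spot 1 0 q ≡ᵇ spot 1 0 i) (occupied occ (spot 1 0 i)))
  where
  fewer : ∀ b c → (if b ∨ c then 0 else 1) ≤ (if c then 0 else 1)
  fewer true  true  = z≤n
  fewer true  false = z≤n
  fewer false c     = ≤-refl
  takesFree : (if (spot 1 0 q ≡ᵇ spot 1 0 q) ∨ occupied occ (spot 1 0 q) then 0 else 1) < (if occupied occ (spot 1 0 q) then 0 else 1)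
  takesFree rewrite det (≡ᵇ-reflects-≡ (spot 1 0 q) (spot 1 0 q)) (ofʸ refl) | free = z<s

parkCar-street-freeSpots : ∀ m {occ occ′} q → q < m → parkCar m 1 occ (spot 1 0 q) ≡ just occ′ → freeSpots m occ′ < freeSpots m occ
parkCar-street-freeSpots m {occ} q q<m parked =
  parkCar-spot-just m occ z<s q (λ occ′ → freeSpots m occ′ < freeSpots m occ) parked
    (freeSpots-∷ m occ q q<m)
    (freeSpots-∷ m occ (pred q) (≤-<-trans pred[n]≤n q<m))
    (λ inRange → freeSpots-∷ m occ (suc q) (Equivalence.to (classSize-street m (suc q)) inRange))

vpf₁-vanishes : ∀ m → VanishesAbove m (vpf₁ m)
vpf₁-vanishes m x = accepted-capacity (parkCar m 1) (freeSpots m) (applyUpTo⁺₁ (spot 1 0) m (λ {q} q<m {occ} {occ′} → parkCar-street-freeSpots m {occ} {occ′} q q<m))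
                                      (suc m + x) [] (s≤s (subst (_≤ m + x) (sym free₀) (m≤m+n m x)))
  where
  free₀ : freeSpots m [] ≡ m
  free₀ = trans (∑-const m 1) (*-identityʳ m)

-- Residue classes park independently

occupied-∷-other : ∀ {k j r} occ q q′ → j < k → r < k → j ≢ r → occupied (spot k j q ∷ occ) (spot k r q′) ≡ occupied occ (spot k r q′)
occupied-∷-other {k} {j} {r} occ q q′ j<k r<k j≢r = cong (_∨ occupied occ (spot k r q′)) (spot-≡ᵇ-other q q′ j<k r<k j≢r)

classesLetters : (k j : ℕ) → List ℕ → List ℕ
classesLetters k j []       = []
classesLetters k j (m ∷ ms) = applyUpTo (spot k j) m ++ classesLetters k (suc j) ms

All-classesLetters : ∀ (P : ℕ → Set) {k} j ms → (∀ {r} q → j ≤ r → r < j + length ms → P (spot k r q)) → All P (classesLetters k j ms)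
All-classesLetters P j []       Pspot = All.[]
All-classesLetters P j (m ∷ ms) Pspot =
  ++⁺ (applyUpTo⁺₁ _ m (λ {q} _ → Pspot q ≤-refl (m<m+n j z<s)))
      (All-classesLetters P (suc j) ms (λ {r} q j<r r<1+j+l → Pspot q (<⇒≤ j<r) (subst (r <_) (sym (+-suc j (length ms))) r<1+j+l)))

classesLetters-++ : ∀ k j xs ys → classesLetters k j (xs ++ ys) ≡ classesLetters k j xs ++ classesLetters k (j + length xs) ys
classesLetters-++ k j []       ys = cong (λ j → classesLetters k j ys) (sym (+-identityʳ j))
classesLetters-++ k j (x ∷ xs) ys = begin
  applyUpTo (spot k j) x ++ classesLetters k (suc j) (xs ++ ys)
    ≡⟨ cong (applyUpTo (spot k j) x ++_) (classesLetters-++ k (suc j) xs ys) ⟩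
  applyUpTo (spot k j) x ++ (classesLetters k (suc j) xs ++ classesLetters k (suc j + length xs) ys)
    ≡⟨ sym (++-assoc (applyUpTo (spot k j) x) _ _) ⟩
  classesLetters k j (x ∷ xs) ++ classesLetters k (suc j + length xs) ys
    ≡⟨ cong (λ j′ → classesLetters k j (x ∷ xs) ++ classesLetters k j′ ys) (sym (+-suc j (length xs))) ⟩
  classesLetters k j (x ∷ xs) ++ classesLetters k (j + suc (length xs)) ys ∎

sum-map-classesLetters-replicate : ∀ (h : ℕ → ℕ) k j c m → sum (map h (classesLetters k j (replicate c m))) ≡ ∑[ r < c ] ∑[ q < m ] h (spot k (j + r) q)
sum-map-classesLetters-replicate h k j zero    m = refl
sum-map-classesLetters-replicate h k j (suc c) m = begin
  sum (map h (applyUpTo (spot k j) m ++ classesLetters k (suc j) (replicate c m)))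
    ≡⟨ trans (cong sum (map-++ h (applyUpTo (spot k j) m) _)) (sum-++ (map h (applyUpTo (spot k j) m)) _) ⟩
  sum (map h (applyUpTo (spot k j) m)) + sum (map h (classesLetters k (suc j) (replicate c m)))
    ≡⟨ cong₂ _+_ (trans (sum-map-applyUpTo h (spot k j) m) (∑-cong m (λ q _ → cong (λ r → h (spot k r q)) (sym (+-identityʳ j)))))
                 (trans (sum-map-classesLetters-replicate h k (suc j) c m) (∑-cong c (λ r _ → ∑-cong m (λ q _ → cong (λ r → h (spot k r q)) (sym (+-suc j r)))))) ⟩
  ∑[ r < suc c ] ∑[ q < m ] h (spot k (j + r) q) ∎

module _ (n k : ℕ) where

  private
    count : List ℕ → ℕ → ℕ
    count L = accepted (parkCar n k) L []

  accepted-class-++ : ∀ {j} m ms → suc j + length ms ≤ k → ∀ x →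
    count (applyUpTo (spot k j) m ++ classesLetters k (suc j) ms) x ≡ shuffle x (count (applyUpTo (spot k j) m)) (count (classesLetters k (suc j) ms))
  accepted-class-++ {j} m ms bound x = accepted-++ Split (parkCar n k) (parkCar n k) (parkCar n k) onClass onLater x ((λ _ → refl) , (λ _ _ _ _ → refl))
    where
    j<k : j < k
    j<k = m+n≤o⇒m≤o (suc j) bound
    Split : List ℕ → List ℕ → List ℕ → Set
    Split x y z = (∀ q → occupied x (spot k j q) ≡ occupied y (spot k j q)) ×
                  (∀ r q → j < r → r < k → occupied x (spot k r q) ≡ occupied z (spot k r q))
    onClass : All (λ a → ∀ {x y z} → Split x y z → Pointwise (λ x′ y′ → Split x′ y′ z) (parkCar n k x a) (parkCar n k y a)) (applyUpTo (spot k j) m)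
    onClass = applyUpTo⁺₁ _ m (λ {q} _ {x} {y} {z} split →
      parkCar-Pointwise {n = n} {n′ = n} j<k j<k (λ _ → refl) (λ x′ y′ → Split x′ y′ z) {x} {y} (proj₁ split)
        (λ q″ → (λ q′ → cong ((spot k j q″ ≡ᵇ spot k j q′) ∨_) (proj₁ split q′))
              , (λ r q′ j<r r<k → trans (occupied-∷-other x q″ q′ j<k r<k (<⇒≢ j<r)) (proj₂ split r q′ j<r r<k)))
        q)
    onLater : All (λ a → ∀ {x y z} → Split x y z → Pointwise (λ x′ z′ → Split x′ y z′) (parkCar n k x a) (parkCar n k z a)) (classesLetters k (suc j) ms)
    onLater = All-classesLetters _ (suc j) ms (λ {r} q j<r r<1+j+l {x} {y} {z} split →
      let r<k = <-≤-trans r<1+j+l bound in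
      parkCar-Pointwise {n = n} {n′ = n} r<k r<k (λ _ → refl) (λ x′ z′ → Split x′ y z′) {x} {z} (λ q′ → proj₂ split r q′ j<r r<k)
        (λ q″ → (λ q′ → trans (occupied-∷-other x q″ q′ r<k j<k (<⇒≢ j<r ∘ sym)) (proj₁ split q′))
              , (λ r′ q′ j<r′ r′<k → cong ((spot k r q″ ≡ᵇ spot k r′ q′) ∨_) (proj₂ split r′ q′ j<r′ r′<k)))
        q)

  ClassSizes : ℕ → List ℕ → Set
  ClassSizes j []       = ⊤
  ClassSizes j (m ∷ ms) = ClassSize n k j m × ClassSizes (suc j) ms

  ClassSizes-++ : ∀ j xs {ys} → ClassSizes j xs → ClassSizes (j + length xs) ys → ClassSizes j (xs ++ ys)
  ClassSizes-++ j []       {ys} _             sizes = subst (λ j → ClassSizes j ys) (+-identityʳ j) sizes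
  ClassSizes-++ j (x ∷ xs) {ys} (size , sizes) sizes′ =
    size , ClassSizes-++ (suc j) xs sizes (subst (λ j → ClassSizes j ys) (+-suc j (length xs)) sizes′)

  ClassSizes-replicate : ∀ j c {m} → (∀ {r} → j ≤ r → r < j + c → ClassSize n k r m) → ClassSizes j (replicate c m)
  ClassSizes-replicate j zero    sizes = _
  ClassSizes-replicate j (suc c) sizes =
    sizes ≤-refl (m<m+n j z<s) , ClassSizes-replicate (suc j) c (λ {r} j<r r<1+j+c → sizes (<⇒≤ j<r) (subst (r <_) (sym (+-suc j c)) r<1+j+c))

  accepted-classes : ∀ j ms → j + length ms ≤ k → ClassSizes j ms →
    VanishesAbove (sum ms) (count (classesLetters k j ms)) ×
    count (classesLetters k j ms) (sum ms) ≡ multinomial ms * product (map (λ m → vpf₁ m m) ms)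
  accepted-classes j []       _     _               = (λ _ → refl) , refl
  accepted-classes j (m ∷ ms) bound (size , sizes) = vanishes , atTop
    where
    bound′ : suc j + length ms ≤ k
    bound′ = subst (_≤ k) (+-suc j (length ms)) bound
    j<k : j < k
    j<k = m+n≤o⇒m≤o (suc j) bound′
    G : ℕ → ℕ
    G = count (classesLetters k (suc j) ms)
    later : VanishesAbove (sum ms) G × G (sum ms) ≡ multinomial ms * product (map (λ m → vpf₁ m m) ms)
    later = accepted-classes (suc j) ms bound′ sizes
    split : ∀ x → count (classesLetters k j (m ∷ ms)) x ≡ shuffle x (vpf₁ m) G
    split x = trans (accepted-class-++ m ms bound′ x)
                    (shuffle-cong x (accepted-class j<k size) (λ _ → refl))
    vanishes : VanishesAbove (m + sum ms) (count (classesLetters k j (m ∷ ms)))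
    vanishes x = trans (split (suc (m + sum ms) + x)) (shuffle-vanishes m (sum ms) (vpf₁-vanishes m) (proj₁ later) x)
    atTop : count (classesLetters k j (m ∷ ms)) (m + sum ms) ≡ multinomial (m ∷ ms) * product (map (λ m → vpf₁ m m) (m ∷ ms))
    atTop = begin
      count (classesLetters k j (m ∷ ms)) (m + sum ms)  ≡⟨ split (m + sum ms) ⟩
      shuffle (m + sum ms) (vpf₁ m) G                   ≡⟨ shuffle-top m (sum ms) (vpf₁-vanishes m) (proj₁ later) ⟩
      ((m + sum ms) C m) * vpf₁ m m * G (sum ms)        ≡⟨ cong (((m + sum ms) C m) * vpf₁ m m *_) (proj₂ later) ⟩
      ((m + sum ms) C m) * vpf₁ m m * (multinomial ms * P) ≡⟨ rearrange ((m + sum ms) C m) (vpf₁ m m) (multinomial ms) P ⟩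
      ((m + sum ms) C m) * multinomial ms * (vpf₁ m m * P) ∎
      where
      P : ℕ
      P = product (map (λ m → vpf₁ m m) ms)
      rearrange : ∀ c v b p → c * v * (b * p) ≡ c * b * (v * p)
      rearrange = solve-∀

digits-< : ∀ {k r q q′} r′ → r < k → q < q′ → r + q * k < r′ + q′ * k
digits-< {k} {r} {q} {q′} r′ r<k q<q′ =
  <-≤-trans (+-monoˡ-< (q * k) r<k) (≤-trans (*-monoˡ-≤ k q<q′) (m≤n+m (q′ * k) r′))

classSizes : (k a b : ℕ) → List ℕ
classSizes k a b = replicate b (suc a) ++ replicate (k ∸ b) a

product-map-classSizes : ∀ (f : ℕ → ℕ) k a b → product (map f (classSizes k a b)) ≡ f (suc a) ^ b * f a ^ (k ∸ b)
product-map-classSizes f k a b = begin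
  product (map f (replicate b (suc a) ++ replicate (k ∸ b) a))                ≡⟨ cong product (map-++ f (replicate b (suc a)) _) ⟩
  product (map f (replicate b (suc a)) ++ map f (replicate (k ∸ b) a))        ≡⟨ product-++ (map f (replicate b (suc a))) _ ⟩
  product (map f (replicate b (suc a))) * product (map f (replicate (k ∸ b) a)) ≡⟨ cong₂ _*_ (power b (suc a)) (power (k ∸ b) a) ⟩
  f (suc a) ^ b * f a ^ (k ∸ b)                                               ∎
  where
  power : ∀ c x → product (map f (replicate c x)) ≡ f x ^ c
  power c x = trans (cong product (map-replicate f c x)) (product-replicate c (f x))

module _ {k a b : ℕ} (b<k : b < k) where

  private
    n d : ℕ
    n = k * a + b
    d = k ∸ b
    b+d≡k : b + d ≡ k
    b+d≡k = m+[n∸m]≡n (<⇒≤ b<k)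
    n≡b+a*k : n ≡ b + a * k
    n≡b+a*k = trans (+-comm (k * a) b) (cong (b +_) (*-comm k a))

  sum-classSizes : sum (classSizes k a b) ≡ n
  sum-classSizes = begin
    sum (classSizes k a b)                          ≡⟨ sum-++ (replicate b (suc a)) _ ⟩
    sum (replicate b (suc a)) + sum (replicate d a) ≡⟨ cong₂ _+_ (sum-replicate b (suc a)) (sum-replicate d a) ⟩
    b * suc a + d * a                               ≡⟨ regroup b d a ⟩
    (b + d) * a + b                                 ≡⟨ cong (λ c → c * a + b) b+d≡k ⟩
    k * a + b                                       ∎
    where
    regroup : ∀ b d a → b * suc a + d * a ≡ (b + d) * a + b
    regroup = solve-∀

  length-classSizes : length (classSizes k a b) ≡ k
  length-classSizes = trans (length-++ (replicate b (suc a))) (trans (cong₂ _+_ (length-replicate b) (length-replicate d)) b+d≡k)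

  classSize-small : ∀ {r} → r < b → ClassSize n k r (suc a)
  classSize-small {r} r<b q = mk⇔ to from
    where
    to : spot k r q ≤ n → q < suc a
    to spot≤n with q ≤? a
    ... | yes q≤a = s≤s q≤a
    ... | no  q≰a = contradiction (subst (r + q * k <_) n≡b+a*k spot≤n) (<-asym (digits-< r b<k (≰⇒> q≰a)))
    from : q < suc a → spot k r q ≤ n
    from (s≤s q≤a) = subst (spot k r q ≤_) (sym n≡b+a*k) (+-mono-<-≤ r<b (*-monoˡ-≤ k q≤a))

  classSize-large : ∀ {r} → b ≤ r → r < k → ClassSize n k r a
  classSize-large {r} b≤r r<k q = mk⇔ to from
    where
    to : spot k r q ≤ n → q < a
    to spot≤n with q <? a
    ... | yes q<a = q<a
    ... | no  q≮a = contradiction (+-mono-≤ b≤r (*-monoˡ-≤ k (≮⇒≥ q≮a))) (<⇒≱ (subst (r + q * k <_) n≡b+a*k spot≤n))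
    from : q < a → spot k r q ≤ n
    from q<a = subst (spot k r q ≤_) (sym n≡b+a*k) (digits-< b r<k q<a)

  classSizes-valid : ClassSizes n k 0 (classSizes k a b)
  classSizes-valid = ClassSizes-++ n k 0 (replicate b (suc a))
    (ClassSizes-replicate n k 0 b (λ _ r<b → classSize-small r<b))
    (ClassSizes-replicate n k (length (replicate b (suc a))) d
      (λ {r} b≤r r<b+d → classSize-large (subst (_≤ r) (length-replicate b) b≤r)
                                     (subst (r <_) (trans (cong (_+ d) (length-replicate b)) b+d≡k) r<b+d)))

  sum-letters-classSizes : ∀ h → sum (map h (applyUpTo suc n)) ≡ sum (map h (classesLetters k 0 (classSizes k a b)))
  sum-letters-classSizes h = begin
    sum (map h (applyUpTo suc n))
      ≡⟨ sum-map-applyUpTo h suc n ⟩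
    ∑[ i < n ] h (suc i)
      ≡⟨ ∑-residues k a b (λ i → h (suc i)) (<⇒≤ b<k) ⟩
    ∑[ r < b ] ∑[ q < suc a ] h (spot k r q) + ∑[ r < d ] ∑[ q < a ] h (spot k (b + r) q)
      ≡⟨ cong (λ c → ∑[ r < b ] ∑[ q < suc a ] h (spot k r q) + ∑[ r < d ] ∑[ q < a ] h (spot k (c + r) q)) (sym (length-replicate b)) ⟩
    ∑[ r < b ] ∑[ q < suc a ] h (spot k r q) + ∑[ r < d ] ∑[ q < a ] h (spot k (length (replicate b (suc a)) + r) q)
      ≡⟨ sym (cong₂ _+_ (sum-map-classesLetters-replicate h k 0 b (suc a)) (sum-map-classesLetters-replicate h k _ d a)) ⟩
    sum (map h (classesLetters k 0 (replicate b (suc a)))) + sum (map h (classesLetters k (length (replicate b (suc a))) (replicate d a)))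
      ≡⟨ sym (trans (cong sum (map-++ h (classesLetters k 0 (replicate b (suc a))) _)) (sum-++ (map h (classesLetters k 0 (replicate b (suc a)))) _)) ⟩
    sum (map h (classesLetters k 0 (replicate b (suc a)) ++ classesLetters k (length (replicate b (suc a))) (replicate d a)))
      ≡⟨ cong (sum ∘ map h) (sym (classesLetters-++ k 0 (replicate b (suc a)) (replicate d a))) ⟩
    sum (map h (classesLetters k 0 (classSizes k a b))) ∎

[m+q*k]/k≡m/k+q : ∀ m q k .{{_ : NonZero k}} → (m + q * k) / k ≡ m / k + q
[m+q*k]/k≡m/k+q m q k = trans (+-distrib-/-∣ʳ m (n∣m*n q)) (cong (m / k +_) (m*n/n≡m q k))

floorFactProd-classSizes : ∀ k′ a b → b < suc k′ → floorFactProd (suc k′ * a + b) (suc k′) ≡ product (map _! (classSizes (suc k′) a b))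
floorFactProd-classSizes k′ a b b<k = begin
  product (map g (upTo k))                                        ≡⟨ cong product (map-upTo g k) ⟩
  product (applyUpTo g k)                                         ≡⟨ cong (product ∘ applyUpTo g) (sym d+b≡k) ⟩
  product (applyUpTo g (d + b))                                   ≡⟨ cong product (applyUpTo-+ g d b) ⟩
  product (applyUpTo g d ++ applyUpTo (λ t → g (d + t)) b)        ≡⟨ cong product (cong₂ _++_ (applyUpTo-const d low) (applyUpTo-const b high)) ⟩
  product (replicate d (a !) ++ replicate b (suc a !))            ≡⟨ product-++ (replicate d (a !)) _ ⟩
  product (replicate d (a !)) * product (replicate b (suc a !))   ≡⟨ cong₂ _*_ (product-replicate d (a !)) (product-replicate b (suc a !)) ⟩
  (a !) ^ d * (suc a !) ^ b                                       ≡⟨ *-comm ((a !) ^ d) _ ⟩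
  (suc a !) ^ b * (a !) ^ d                                       ≡⟨ sym (product-map-classSizes _! k a b) ⟩
  product (map _! (classSizes k a b))                             ∎
  where
  k n d : ℕ
  k = suc k′
  n = k * a + b
  d = k ∸ b
  g : ℕ → ℕ
  g t = ((n + t) / k) !
  d+b≡k : d + b ≡ k
  d+b≡k = m∸n+n≡m (<⇒≤ b<k)
  low : ∀ t → t < d → g t ≡ a !
  low t t<d = cong _! (begin
    (k * a + b + t) / k   ≡⟨ cong (_/ k) (regroup k a b t) ⟩
    (b + t + a * k) / k   ≡⟨ [m+q*k]/k≡m/k+q (b + t) a k ⟩
    (b + t) / k + a       ≡⟨ cong (_+ a) (m<n⇒m/n≡0 (subst (b + t <_) (trans (+-comm b d) d+b≡k) (+-monoʳ-< b t<d))) ⟩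
    a                     ∎)
    where
    regroup : ∀ k a b t → k * a + b + t ≡ b + t + a * k
    regroup = solve-∀
  high : ∀ t → t < b → g (d + t) ≡ suc a !
  high t t<b = cong _! (begin
    (k * a + b + (d + t)) / k   ≡⟨ cong (_/ k) (trans (regroup k a b d t) (cong (λ c → t + (c + a * k)) (trans (+-comm b d) d+b≡k))) ⟩
    (t + suc a * k) / k         ≡⟨ [m+q*k]/k≡m/k+q t (suc a) k ⟩
    t / k + suc a               ≡⟨ cong (_+ suc a) (m<n⇒m/n≡0 (<-trans t<b b<k)) ⟩
    suc a                       ∎)
    where
    regroup : ∀ k a b d t → k * a + b + (d + t) ≡ t + (b + d + a * k)
    regroup = solve-∀

multinom≡multinomial : ∀ n k ms → sum ms ≡ n → floorFactProd n k ≡ product (map _! ms) → multinom n k ≡ multinomial ms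
multinom≡multinomial n k ms sum≡n floor≡ = begin
  (n ! / floorFactProd n k)                         ≡⟨ cong (_/ floorFactProd n k) (sym (cong _! sum≡n)) ⟩
  (sum ms ! / floorFactProd n k)                    ≡⟨ cong (_/ floorFactProd n k) (sym (multinomial-factorials ms)) ⟩
  (multinomial ms * product (map _! ms) / floorFactProd n k) ≡⟨ cong (λ p → multinomial ms * p / floorFactProd n k) (sym floor≡) ⟩
  (multinomial ms * floorFactProd n k / floorFactProd n k)   ≡⟨ m*n/n≡m (multinomial ms) (floorFactProd n k) ⟩
  multinomial ms                                    ∎
  where instance _ = floorFactProdNZ n k

theorem4p1 : (n k a b : ℕ) → 1 ≤ k → k ≤ n → n ≡ k * a + b → b < k →
    vpfCount n k ≡ multinom n k * vpfCount1 (a + 1) ^ b * vpfCount1 a ^ (k ∸ b)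
theorem4p1 _ k@(suc k′) a b _ _ refl b<k = begin
  vpfCount n k                                              ≡⟨ vpfCount≡accepted n k ⟩
  count (applyUpTo suc n) n                                 ≡⟨ accepted-cong (parkCar n k) (sum-letters-classSizes b<k) n [] ⟩
  count letters n                                           ≡⟨ cong (count letters) (sym (sum-classSizes b<k)) ⟩
  count letters (sum sizes)                                 ≡⟨ proj₂ (accepted-classes n k 0 sizes (≤-reflexive (length-classSizes b<k)) (classSizes-valid b<k)) ⟩
  multinomial sizes * product (map (λ m → vpf₁ m m) sizes)  ≡⟨ cong₂ _*_ (sym multinom≡) (product-map-classSizes (λ m → vpf₁ m m) k a b) ⟩
  multinom n k * (vpf₁ (suc a) (suc a) ^ b * vpf₁ a a ^ (k ∸ b))
      ≡⟨ cong₂ (λ x y → multinom n k * (x ^ b * y ^ (k ∸ b))) (trans (vpf₁≡vpfCount1 (suc a)) (cong vpfCount1 (+-comm 1 a))) (vpf₁≡vpfCount1 a) ⟩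
  multinom n k * (vpfCount1 (a + 1) ^ b * vpfCount1 a ^ (k ∸ b)) ≡⟨ sym (*-assoc (multinom n k) _ _) ⟩
  multinom n k * vpfCount1 (a + 1) ^ b * vpfCount1 a ^ (k ∸ b) ∎
  where
  n : ℕ
  n = k * a + b
  sizes letters : List ℕ
  sizes = classSizes k a b
  letters = classesLetters k 0 sizes
  count : List ℕ → ℕ → ℕ
  count L = accepted (parkCar n k) L []
  multinom≡ : multinom n k ≡ multinomial sizes
  multinom≡ = multinom≡multinomial n k sizes (sum-classSizes b<k) (floorFactProd-classSizes k′ a b b<k)
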